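{- Let $(C,<)$ be a tame chain. Then $C$ has a reconstructible well ordering: there are a monadic formula $\varphi(x,y,\bar Z)$, a finite sequence $\bar P$ of subsets of $C$ and an ordinal $\alpha$ such that $\varphi(x,y,\bar P)$ defines in $(C,<)$ a well ordering of $C$ of order type $\alpha$, and there are a monadic formula $\psi(x,y,\bar W)$ and a finite sequence $\bar Q$ of subsets of $\alpha$ such that $\psi(x,y,\bar Q)$ defines in $(\alpha,<)$ a linear order $<^*$ on $\alpha$ with $(\alpha,<^*)\cong(C,<)$.
   Context: A chain is a linearly ordered set. Monadic second-order logic over a chain $(C,<)$ has variables for elements and for arbitrary subsets of $C$, allows quantification over both, and has atomic formulas $x<y$, $x=y$, $x\in X$; a formula $\varphi(x,y,\bar P)$ with parameters $\bar P\subseteq C$ defines the relation $\{(a,b):(C,<)\models\varphi(a,b,\bar P)\}$. Hausdorff degree: $\mathrm{Hdeg}(C)\le 1$ iff $C$ is well ordered or inversely well ordered; $\mathrm{Hdeg}(C)\le n+1$ iff $C=\sum_{i\in I}C_i$ (ordered concatenation) where $I$ is well ordered or inversely well ordered and $\mathrm{Hdeg}(C_i)\le n$ for all $i$. A chain is tame if it is scattered and $\mathrm{Hdeg}(C)\le n$ for some $n<\omega$. -}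

module Defs where

open import Level using (Level; Lift; _⊔_) renaming (suc to lsuc; zero to lzero)
open import Data.Nat using (ℕ; zero; suc)
open import Data.Fin using (Fin)
open import Data.Product using (Σ; Σ-syntax; _×_; _,_; proj₁; proj₂)
open import Data.Sum using (_⊎_)
open import Data.Empty using (⊥)
open import Data.Vec.Functional using (Vector; _∷_; [])
open import Data.Rational as ℚ using (ℚ)
open import Function using (flip)
open import Relation.Nullary using (¬_)
open import Relation.Unary using (Pred; _∈_)
open import Relation.Binary using (Rel)
open import Relation.Binary.Structures using (IsStrictTotalOrder)
open import Relation.Binary.PropositionalEquality using (_≡_)
open import Induction.WellFounded using (WellFounded)

record Chain (ℓ : Level) : Set (lsuc ℓ) where
  field
    Carrier : Set ℓ
    _<_     : Rel Carrier ℓ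
    isSTO   : IsStrictTotalOrder _≡_ _<_

open Chain public

IsLinearOrder : ∀ {a r} {A : Set a} → Rel A r → Set (a ⊔ r)
IsLinearOrder R = IsStrictTotalOrder _≡_ R

IsWellOrdering : ∀ {a r} {A : Set a} → Rel A r → Set (a ⊔ r)
IsWellOrdering R = IsLinearOrder R × WellFounded R

record OrderIso {a r b s} (A : Set a) (R : Rel A r) (B : Set b) (S : Rel B s)
       : Set (a ⊔ r ⊔ b ⊔ s) where
  field
    to       : A → B
    from     : B → A
    from-to  : ∀ x → from (to x) ≡ x
    to-from  : ∀ y → to (from y) ≡ y
    preserve : ∀ x y → R x y → S (to x) (to y)
    reflect  : ∀ x y → S (to x) (to y) → R x y

WellOrdered : ∀ {ℓ} → Chain ℓ → Set ℓ
WellOrdered C = WellFounded (_<_ C)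

InvWellOrdered : ∀ {ℓ} → Chain ℓ → Set ℓ
InvWellOrdered C = WellFounded (flip (_<_ C))

SumCarrier : ∀ {ℓ} (I : Chain ℓ) (D : Carrier I → Chain ℓ) → Set ℓ
SumCarrier I D = Σ (Carrier I) (λ i → Carrier (D i))

data SumLt {ℓ} (I : Chain ℓ) (D : Carrier I → Chain ℓ)
     : Rel (SumCarrier I D) ℓ where
  inter : ∀ {i j x y} → _<_ I i j → SumLt I D (i , x) (j , y)
  intra : ∀ {i x y} → _<_ (D i) x y → SumLt I D (i , x) (i , y)

-- Hausdorff degree:  HdegLE n C  means  Hdeg(C) ≤ n.
-- (Hdeg ≤ 0 is taken to be impossible; the paper's definition starts at 1.)

HdegLE : ∀ {ℓ} → ℕ → Chain ℓ → Set (lsuc ℓ)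
HdegLE zero C = Lift _ ⊥
HdegLE (suc zero) C = Lift _ (WellOrdered C ⊎ InvWellOrdered C)
HdegLE {ℓ} (suc (suc n)) C =
  Σ[ I ∈ Chain ℓ ] (WellOrdered I ⊎ InvWellOrdered I) ×
  Σ[ D ∈ (Carrier I → Chain ℓ) ] (∀ i → HdegLE (suc n) (D i)) ×
  OrderIso (Carrier C) (_<_ C) (SumCarrier I D) (SumLt I D)

Scattered : ∀ {ℓ} → Chain ℓ → Set ℓ
Scattered C = ¬ (Σ[ f ∈ (ℚ → Carrier C) ] (∀ p q → p ℚ.< q → _<_ C (f p) (f q)))

Tame : ∀ {ℓ} → Chain ℓ → Set (lsuc ℓ)
Tame C = Scattered C × Σ[ n ∈ ℕ ] HdegLE n C

-- Monadic second-order logic over chains, with de Bruijn indices: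
-- Formula m k has m free element variables and k free set variables.

data Formula : ℕ → ℕ → Set where
  lt  : ∀ {m k} → Fin m → Fin m → Formula m k
  eq  : ∀ {m k} → Fin m → Fin m → Formula m k
  mem : ∀ {m k} → Fin m → Fin k → Formula m k
  neg : ∀ {m k} → Formula m k → Formula m k
  and : ∀ {m k} → Formula m k → Formula m k → Formula m k
  or  : ∀ {m k} → Formula m k → Formula m k → Formula m k
  ex1 : ∀ {m k} → Formula (suc m) k → Formula m k
  all1 : ∀ {m k} → Formula (suc m) k → Formula m k
  ex2 : ∀ {m k} → Formula m (suc k) → Formula m k
  all2 : ∀ {m k} → Formula m (suc k) → Formula m k

Sat : ∀ {ℓ m k} (C : Chain ℓ) → Formula m k →
      Vector (Carrier C) m → Vector (Pred (Carrier C) ℓ) k → Set (lsuc ℓ)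
Sat C (lt x y)  ρ σ = Lift _ (_<_ C (ρ x) (ρ y))
Sat C (eq x y)  ρ σ = Lift _ (ρ x ≡ ρ y)
Sat C (mem x X) ρ σ = Lift _ (ρ x ∈ σ X)
Sat C (neg φ)   ρ σ = ¬ Sat C φ ρ σ
Sat C (and φ ψ) ρ σ = Sat C φ ρ σ × Sat C ψ ρ σ
Sat C (or φ ψ)  ρ σ = Sat C φ ρ σ ⊎ Sat C ψ ρ σ
Sat C (ex1 φ)   ρ σ = Σ[ c ∈ Carrier C ] Sat C φ (c ∷ ρ) σ
Sat C (all1 φ)  ρ σ = ∀ c → Sat C φ (c ∷ ρ) σ
Sat C (ex2 φ)   ρ σ = Σ[ X ∈ Pred (Carrier C) _ ] Sat C φ ρ (X ∷ σ)
Sat C (all2 φ)  ρ σ = ∀ X → Sat C φ ρ (X ∷ σ)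

Defined : ∀ {ℓ k} (C : Chain ℓ) → Formula 2 k →
          Vector (Pred (Carrier C) ℓ) k → Rel (Carrier C) (lsuc ℓ)
Defined C φ P a b = Sat C φ (a ∷ b ∷ []) P

-- Reconstructible well ordering.  The ordinal α is represented by a
-- well-ordered chain (an ordinal up to isomorphism).

ReconstructibleWO : ∀ {ℓ} → Chain ℓ → Set (lsuc ℓ)
ReconstructibleWO {ℓ} C =
  Σ[ k ∈ ℕ ] Σ[ φ ∈ Formula 2 k ] Σ[ P ∈ Vector (Pred (Carrier C) ℓ) k ]
  Σ[ α ∈ Chain ℓ ] WellOrdered α ×
  IsWellOrdering (Defined C φ P) ×
  OrderIso (Carrier C) (Defined C φ P) (Carrier α) (_<_ α) ×
  (Σ[ k′ ∈ ℕ ] Σ[ ψ ∈ Formula 2 k′ ] Σ[ Q ∈ Vector (Pred (Carrier α) ℓ) k′ ]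
     IsLinearOrder (Defined α ψ Q) ×
     OrderIso (Carrier α) (Defined α ψ Q) (Carrier C) (_<_ C))

{-# OPTIONS --safe #-}

-- Induction on the Hausdorff degree produces a well ordering ≺ of C and a single formula φ n with
-- parameters that defines ≺ in (C, <) and also < in (C, ≺). For a sum C = Σ_{i ∈ I} D i with I
-- well ordered or inversely well ordered, ≺ is the lexicographic sum of the blocks' well
-- orderings over I ordered well-foundedly. To recognise blocks, colour the nonempty ones by
-- alternating along immediate successors of that well-founded order: two points are in the same
-- block iff no point between them differs in colour from the first. Across blocks a one-set
-- parameter says whether the index order is kept or reversed; within a block the formula of the
-- lower degree applies, and still does inside the whole sum because blocks are convex.
module Submission where

open import Defs
open import Axiom.ExcludedMiddle using (ExcludedMiddle)
open import Level using (Level; Lift; lift; lower; 0ℓ)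
open import Data.Nat using (ℕ; zero; suc)
open import Data.Fin using (Fin; zero; suc; #_)
open import Data.Bool using (Bool; true; false; not; T) renaming (_≟_ to _≟ᵇ_)
open import Data.Bool.Properties using (not-¬)
open import Data.Product using (Σ; Σ-syntax; ∃-syntax; _×_; _,_; proj₁; proj₂)
import Data.Product as Prod
open import Data.Sum using (_⊎_; inj₁; inj₂)
import Data.Sum as Sum
open import Data.Empty using (⊥-elim)
open import Data.Vec.Functional using (Vector; _∷_; [])
open import Function using (flip; _∘_; _on_; id; _⇔_; mk⇔; Equivalence)
open import Function.Construct.Composition using (_⇔-∘_)
open import Function.Construct.Symmetry using (⇔-sym)
open import Function.Related.Propositional using (module EquationalReasoning)
open import Relation.Nullary using (¬_; Dec; yes; no; contradiction)
open import Relation.Unary using (Pred)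
open import Relation.Binary
  using (Rel; IsStrictTotalOrder; isStrictTotalOrderᶜ; Tri; tri<; tri≈; tri>)
import Relation.Binary.Construct.Flip.EqAndOrd as Flip
import Relation.Binary.Construct.On as On
open import Relation.Binary.PropositionalEquality
  using (_≡_; _≢_; refl; sym; trans; cong; subst; subst₂; isEquivalence)
open import Induction.WellFounded
  using (WellFounded; Acc; acc; module All; module FixPoint; module Subrelation)

open Equivalence using (to; from)

private
  variable
    ℓ r s : Level

orient : {A : Set ℓ} → Bool → Rel A r → Rel A r
orient false R = R
orient true  R = flip R

orient-involutive : ∀ b {A : Set ℓ} {R : Rel A r} → orient b (orient b R) ≡ R
orient-involutive false = refl
orient-involutive true  = refl

orient-⇔ : ∀ b {X Y : Set ℓ} {R : Rel X r} {S : Rel Y s} {f : X → Y} →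
           (∀ {x y} → R x y ⇔ S (f x) (f y)) →
           ∀ {x y} → orient b R x y ⇔ orient b S (f x) (f y)
orient-⇔ false R⇔S = R⇔S
orient-⇔ true  R⇔S = R⇔S

orient-isStrictTotalOrder : ∀ b {A : Set ℓ} {R : Rel A r} →
  IsStrictTotalOrder _≡_ R → IsStrictTotalOrder _≡_ (orient b R)
orient-isStrictTotalOrder false sto = sto
orient-isStrictTotalOrder true  sto = Flip.isStrictTotalOrder sto

isStrictTotalOrder-pullback : {X Y : Set ℓ} {R : Rel X r} {S : Rel Y s} (f : X → Y) →
  (∀ {x y} → f x ≡ f y → x ≡ y) → (∀ {x y} → R x y ⇔ S (f x) (f y)) →
  IsStrictTotalOrder _≡_ S → IsStrictTotalOrder _≡_ R
isStrictTotalOrder-pullback {R = R} f f-injective R⇔S sto = isStrictTotalOrderᶜ record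
  { isEquivalence = isEquivalence
  ; trans = λ xRy yRz → from R⇔S (IsStrictTotalOrder.trans sto (to R⇔S xRy) (to R⇔S yRz))
  ; compare = compare
  }
  where
  compare : ∀ x y → Tri (R x y) (x ≡ y) (R y x)
  compare x y with IsStrictTotalOrder.compare sto (f x) (f y)
  ... | tri< s fx≢fy s′ = tri< (from R⇔S s) (fx≢fy ∘ cong f) (s′ ∘ to R⇔S)
  ... | tri≈ s fx≡fy s′ = tri≈ (s ∘ to R⇔S) (f-injective fx≡fy) (s′ ∘ to R⇔S)
  ... | tri> s fx≢fy s′ = tri> (s ∘ to R⇔S) (fx≢fy ∘ cong f) (from R⇔S s′)

isWellOrdering-resp-⇔ : {X : Set ℓ} {R : Rel X r} {S : Rel X s} → (∀ {x y} → R x y ⇔ S x y) →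
                        IsWellOrdering S → IsWellOrdering R
isWellOrdering-resp-⇔ R⇔S (S-sto , S-wf) =
  isStrictTotalOrder-pullback id id R⇔S S-sto , Subrelation.wellFounded (to R⇔S) S-wf

OrderIso-id : {X : Set ℓ} {R : Rel X r} {S : Rel X s} → (∀ {x y} → R x y ⇔ S x y) → OrderIso X R X S
OrderIso-id R⇔S = record
  { to = id ; from = id ; from-to = λ _ → refl ; to-from = λ _ → refl
  ; preserve = λ _ _ → to R⇔S ; reflect = λ _ _ → from R⇔S }

data Lex {A : Set ℓ} {D : A → Set ℓ} (O : Rel A ℓ) (R : ∀ i → Rel (D i) ℓ) :
         Rel (Σ A D) ℓ where
  inter : ∀ {i j x y} → O i j → Lex O R (i , x) (j , y)
  intra : ∀ {i x y} → R i x y → Lex O R (i , x) (i , y)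

module _ {A : Set ℓ} {D : A → Set ℓ} {O : Rel A ℓ} {R : ∀ i → Rel (D i) ℓ} where

  Lex-within : (∀ {i} → ¬ O i i) → ∀ {i x y} → Lex O R (i , x) (i , y) ⇔ R i x y
  Lex-within O-irrefl = mk⇔ (λ { (inter o) → contradiction o O-irrefl ; (intra r) → r }) intra

  Lex-across : ∀ {i j x y} → i ≢ j → Lex O R (i , x) (j , y) ⇔ O i j
  Lex-across i≢j = mk⇔ (λ { (inter o) → o ; (intra _) → contradiction refl i≢j }) inter

  orient-Lex-across : ∀ b {i j x y} → i ≢ j → orient b (Lex O R) (i , x) (j , y) ⇔ orient b O i j
  orient-Lex-across false i≢j = Lex-across i≢j
  orient-Lex-across true  i≢j = Lex-across (i≢j ∘ sym)

  module _ (O-sto : IsStrictTotalOrder _≡_ O) where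
    open IsStrictTotalOrder O-sto using (compare) renaming (irrefl to O-irrefl; trans to O-trans)

    Lex-squeeze : ∀ {i k x y w} → Lex O R (i , x) (k , w) → Lex O R (k , w) (i , y) → k ≡ i
    Lex-squeeze (inter o) (inter o′) = contradiction (O-trans o o′) (O-irrefl refl)
    Lex-squeeze (intra _) _          = refl
    Lex-squeeze _         (intra _)  = refl

    Lex-isStrictTotalOrder : (∀ i → IsStrictTotalOrder _≡_ (R i)) → IsStrictTotalOrder _≡_ (Lex O R)
    Lex-isStrictTotalOrder R-sto = isStrictTotalOrderᶜ record
      { isEquivalence = isEquivalence
      ; trans = Lex-trans
      ; compare = Lex-compare
      }
      where
      Lex-trans : ∀ {p q s} → Lex O R p q → Lex O R q s → Lex O R p s
      Lex-trans (inter o) (inter o′) = inter (O-trans o o′)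
      Lex-trans (inter o) (intra _)  = inter o
      Lex-trans (intra _) (inter o′) = inter o′
      Lex-trans {i , _} (intra r) (intra r′) = intra (IsStrictTotalOrder.trans (R-sto i) r r′)

      within : ∀ {i x y} → Lex O R (i , x) (i , y) ⇔ R i x y
      within = Lex-within (O-irrefl refl)

      Lex-compare : ∀ p q → Tri (Lex O R p q) (p ≡ q) (Lex O R q p)
      Lex-compare (i , x) (j , y) with compare i j
      ... | tri< o i≢j o′ = tri< (inter o) (i≢j ∘ cong proj₁) (o′ ∘ to (Lex-across (i≢j ∘ sym)))
      ... | tri> o′ i≢j o = tri> (o′ ∘ to (Lex-across i≢j)) (i≢j ∘ cong proj₁) (inter o)
      ... | tri≈ _ refl _ with IsStrictTotalOrder.compare (R-sto i) x y
      ...   | tri< r x≢y r′ = tri< (intra r) (λ { refl → x≢y refl }) (r′ ∘ to within)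
      ...   | tri≈ r refl r′ = tri≈ (r ∘ to within) refl (r′ ∘ to within)
      ...   | tri> r x≢y r′ = tri> (r ∘ to within) (λ { refl → x≢y refl }) (intra r′)

  Lex-wellFounded : WellFounded O → (∀ i → WellFounded (R i)) → WellFounded (Lex O R)
  Lex-wellFounded O-wf R-wf (i , x) = accessible (O-wf i) (R-wf i x)
    where
    accessible : ∀ {i} → Acc O i → ∀ {x} → Acc (R i) x → Acc (Lex O R) (i , x)
    accessible {i} (acc O-rs) = within
      where
      within : ∀ {x} → Acc (R i) x → Acc (Lex O R) (i , x)
      within (acc R-rs) = acc λ
        { (inter o) → accessible (O-rs o) (R-wf _ _)
        ; (intra r) → within (R-rs r) }

OrderIso-Lex : ∀ {X : Set ℓ} {R : Rel X ℓ} {I : Chain ℓ} {D : Carrier I → Chain ℓ} →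
               OrderIso X R (SumCarrier I D) (SumLt I D) →
               OrderIso X R (SumCarrier I D) (Lex (_<_ I) (λ i → _<_ (D i)))
OrderIso-Lex iso = record
  { to = OrderIso.to iso ; from = OrderIso.from iso ; from-to = from-to ; to-from = to-from
  ; preserve = λ a b → SumLt⇒Lex ∘ preserve a b
  ; reflect = λ a b → reflect a b ∘ Lex⇒SumLt
  }
  where
  open OrderIso iso using (from-to; to-from; preserve; reflect)
  SumLt⇒Lex : ∀ {p q} → SumLt _ _ p q → Lex _ _ p q
  SumLt⇒Lex (inter o) = inter o
  SumLt⇒Lex (intra r) = intra r
  Lex⇒SumLt : ∀ {p q} → Lex _ _ p q → SumLt _ _ p q
  Lex⇒SumLt (inter o) = inter o
  Lex⇒SumLt (intra r) = intra r

Between : {A : Set ℓ} → Rel A ℓ → A → A → A → Set ℓ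
Between O i k j = (O i k × O k j) ⊎ (O j k × O k i)

Separates : {A : Set ℓ} → Rel A ℓ → Pred A ℓ → (A → Bool) → Set ℓ
Separates {A = A} O Ne colour =
  ∀ {i j} → Ne i → Ne j → i ≢ j →
  Σ[ k ∈ A ] colour k ≢ colour i × (k ≡ j ⊎ Ne k × Between O i k j)

Between-flip : {A : Set ℓ} {O : Rel A ℓ} {i k j : A} → Between O i k j → Between (flip O) i k j
Between-flip (inj₁ (i<k , k<j)) = inj₂ (k<j , i<k)
Between-flip (inj₂ (j<k , k<i)) = inj₁ (k<i , j<k)

Separates-flip : {A : Set ℓ} {O : Rel A ℓ} {Ne : Pred A ℓ} {colour : A → Bool} →
                 Separates O Ne colour → Separates (flip O) Ne colour
Separates-flip {O = O} sep ni nj i≢j with sep ni nj i≢j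
... | k , differs , k≡j⊎between =
  k , differs , Sum.map₂ (Prod.map₂ (Between-flip {O = O})) k≡j⊎between

Separates-unorient : ∀ b {A : Set ℓ} {O : Rel A ℓ} {Ne : Pred A ℓ} {colour : A → Bool} →
                     Separates (orient b O) Ne colour → Separates O Ne colour
Separates-unorient false sep = sep
Separates-unorient true  sep = Separates-flip sep

module Colouring (em : ExcludedMiddle ℓ) {A : Set ℓ} {O : Rel A ℓ}
                 (O-sto : IsStrictTotalOrder _≡_ O) (O-wf : WellFounded O) (Ne : Pred A ℓ) where

  open IsStrictTotalOrder O-sto using (compare)

  minimal : (Q : Pred A ℓ) → ∀ {j} → Q j → ∃[ s ] Q s × (∀ {t} → Q t → ¬ O t s)
  minimal Q {j} qj with em {∃[ s ] Q s × (∀ {t} → Q t → ¬ O t s)}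
  ... | yes s-minimal = s-minimal
  ... | no ∄minimal = contradiction qj (noneBelow (O-wf j))
    where
    noneBelow : ∀ {t} → Acc O t → ¬ Q t
    noneBelow (acc rs) qt = ∄minimal (_ , qt , λ qu u<t → noneBelow (rs u<t) qu)

  _⋖_ : A → A → Set ℓ
  p ⋖ k = Ne p × O p k × (∀ {t} → Ne t → O p t → ¬ O t k)

  ⋖-unique : ∀ {p q k} → p ⋖ k → q ⋖ k → p ≡ q
  ⋖-unique {p} {q} (np , p<k , p-cover) (nq , q<k , q-cover) with compare p q
  ... | tri< p<q _ _ = contradiction q<k (p-cover nq p<q)
  ... | tri≈ _ p≡q _ = p≡q
  ... | tri> _ _ q<p = contradiction p<k (q-cover np q<p)

  successor : ∀ {i j} → Ne i → Ne j → O i j → ∃[ s ] Ne s × i ⋖ s × (s ≡ j ⊎ O s j)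
  successor {i} {j} ni nj i<j with minimal (λ t → Ne t × O i t) (nj , i<j)
  ... | s , (ns , i<s) , s-minimal =
    s , ns , (ni , i<s , λ nt i<t → s-minimal (nt , i<t)) , s≤j (compare s j)
    where
    s≤j : Tri (O s j) (s ≡ j) (O j s) → s ≡ j ⊎ O s j
    s≤j (tri< s<j _ _) = inj₂ s<j
    s≤j (tri≈ _ s≡j _) = inj₁ s≡j
    s≤j (tri> _ _ j<s) = contradiction j<s (s-minimal (nj , i<j))

  -- colour k is the parity of the number of successor steps from the nearest point below k
  -- (inclusive) that has no immediate predecessor.
  colourStep : ∀ k → (∀ {p} → O p k → Bool) → Bool
  colourStep k colourBelow with em {∃[ p ] p ⋖ k}
  ... | yes (p , _ , p<k , _) = not (colourBelow p<k)
  ... | no _ = false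

  colourStep-ext : ∀ k {c c′ : ∀ {p} → O p k → Bool} →
                   (∀ {p} (p<k : O p k) → c p<k ≡ c′ p<k) → colourStep k c ≡ colourStep k c′
  colourStep-ext k c≡c′ with em {∃[ p ] p ⋖ k}
  ... | yes (p , _ , p<k , _) = cong not (c≡c′ p<k)
  ... | no _ = refl

  colour : A → Bool
  colour = All.wfRec O-wf 0ℓ (λ _ → Bool) colourStep

  colour-flips : ∀ {p k} → p ⋖ k → colour k ≢ colour p
  colour-flips {p} {k} p⋖k
    rewrite FixPoint.unfold-wfRec O-wf (λ _ → Bool) colourStep colourStep-ext {k}
    with em {∃[ q ] q ⋖ k}
  ... | no ∄pred = contradiction (p , p⋖k) ∄pred
  ... | yes (q , q⋖k) with ⋖-unique q⋖k p⋖k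
  ...   | refl = not-¬ refl ∘ sym

  separates : Separates O Ne colour
  separates {i} {j} ni nj i≢j with compare i j
  ... | tri≈ _ i≡j _ = contradiction i≡j i≢j
  ... | tri< i<j _ _ with successor ni nj i<j
  ...   | s , _  , i⋖s , inj₁ s≡j = s , colour-flips i⋖s , inj₁ s≡j
  ...   | s , ns , i⋖s@(_ , i<s , _) , inj₂ s<j =
    s , colour-flips i⋖s , inj₂ (ns , inj₁ (i<s , s<j))
  separates {i} {j} ni nj i≢j | tri> _ _ j<i with colour j ≟ᵇ colour i
  ... | no differs = j , differs , inj₁ refl
  ... | yes same with successor nj ni j<i
  ...   | s , _  , j⋖s , inj₁ refl = contradiction same (colour-flips j⋖s ∘ sym)
  ...   | s , ns , j⋖s@(_ , j<s , _) , inj₂ s<i =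
    s , colour-flips j⋖s ∘ (λ s≡i → trans s≡i (sym same)) , inj₂ (ns , inj₂ (j<s , s<i))

leq : ∀ {m k} → Fin m → Fin m → Formula m k
leq u v = or (lt u v) (eq u v)

between : ∀ {m k} → Fin m → Fin m → Fin m → Formula m k
between u w v = or (and (leq u w) (leq w v)) (and (leq v w) (leq w u))

differ : ∀ {m k} → Fin m → Fin m → Fin k → Formula m k
differ u v X = or (and (mem u X) (neg (mem v X))) (and (neg (mem u X)) (mem v X))

-- Under ex1 the quantified point z is # 0, while x and y become # 1 and # 2.
sameBlock : ∀ {k} → Fin k → Formula 2 k
sameBlock X = neg (ex1 (and (between (# 1) (# 0) (# 2)) (differ (# 0) (# 1) X)))

oriented : ∀ {k} → Fin k → Formula 2 k
oriented X = or (and (mem (# 0) X) (lt (# 1) (# 0))) (and (neg (mem (# 0) X)) (lt (# 0) (# 1)))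

paramCount : ℕ → ℕ
paramCount zero          = zero
paramCount (suc zero)    = 1
paramCount (suc (suc n)) = suc (suc (paramCount (suc n)))

φ : ∀ n {k} → (Fin (paramCount n) → Fin k) → Formula 2 k
φ zero          ix = lt (# 0) (# 0)  -- never used: HdegLE 0 C is empty
φ (suc zero)    ix = oriented (ix zero)
φ (suc (suc n)) ix =
  or (and (neg (sameBlock (ix zero))) (oriented (ix (# 1))))
     (and (sameBlock (ix zero)) (φ (suc n) (λ t → ix (suc (suc t)))))

exactlyOne⇔≢ : ∀ {a m} {M N : Set m} {b c : Bool} → M ⇔ Lift m (T b) → N ⇔ Lift m (T c) →
               ((Lift a M × ¬ Lift a N) ⊎ (¬ Lift a M × Lift a N)) ⇔ (b ≢ c)
exactlyOne⇔≢ {b = true}  {true}  M⇔b N⇔c =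
  mk⇔ (λ { (inj₁ (_ , ¬N)) → contradiction (lift (from N⇔c _)) ¬N
         ; (inj₂ (¬M , _)) → contradiction (lift (from M⇔b _)) ¬M })
      (λ b≢c → contradiction refl b≢c)
exactlyOne⇔≢ {b = false} {false} M⇔b N⇔c =
  mk⇔ (λ { (inj₁ (lift m , _)) → ⊥-elim (lower (to M⇔b m))
         ; (inj₂ (_ , lift n)) → ⊥-elim (lower (to N⇔c n)) })
      (λ b≢c → contradiction refl b≢c)
exactlyOne⇔≢ {b = true}  {false} M⇔b N⇔c =
  mk⇔ (λ _ ()) (λ _ → inj₁ (lift (from M⇔b _) , λ { (lift n) → lower (to N⇔c n) }))
exactlyOne⇔≢ {b = false} {true}  M⇔b N⇔c =
  mk⇔ (λ _ ()) (λ _ → inj₂ ((λ { (lift m) → lower (to M⇔b m) }) , lift (from N⇔c _)))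

Sat-between-right : ∀ {E : Chain ℓ} {k} {σ : Vector (Pred (Carrier E) ℓ) k} (x y : Carrier E) →
                    Sat E (between (# 1) (# 0) (# 2)) (y ∷ x ∷ y ∷ []) σ
Sat-between-right {E = E} x y with IsStrictTotalOrder.compare (isSTO E) x y
... | tri< x<y _ _ = inj₁ (inj₁ (lift x<y) , inj₂ (lift refl))
... | tri≈ _ x≡y _ = inj₁ (inj₂ (lift x≡y) , inj₂ (lift refl))
... | tri> _ _ y<x = inj₂ (inj₂ (lift refl) , inj₁ (lift y<x))

Sat-oriented : ∀ {E : Chain ℓ} {k} {σ : Vector (Pred (Carrier E) ℓ) k} {X} b {x y} →
               σ X x ⇔ Lift ℓ (T b) → Sat E (oriented X) (x ∷ y ∷ []) σ ⇔ orient b (_<_ E) x y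
Sat-oriented false x∈X =
  mk⇔ (λ { (inj₁ (lift x∈X′ , _)) → ⊥-elim (lower (to x∈X x∈X′)) ; (inj₂ (_ , lift x<y)) → x<y })
      (λ x<y → inj₂ ((λ { (lift x∈X′) → lower (to x∈X x∈X′) }) , lift x<y))
Sat-oriented true x∈X =
  mk⇔ (λ { (inj₁ (_ , lift y<x)) → y<x ; (inj₂ (x∉X , _)) → contradiction (lift (from x∈X _)) x∉X })
      (λ y<x → inj₁ (lift (from x∈X _) , lift y<x))

record ConvexEmbedding {X : Set ℓ} (R : Rel X ℓ) (E : Chain ℓ) : Set ℓ where
  field
    embed  : X → Carrier E
    order  : ∀ {a b} → R a b ⇔ _<_ E (embed a) (embed b)
    convex : ∀ {a b z} → _<_ E (embed a) z → _<_ E z (embed b) → Σ[ c ∈ X ] embed c ≡ z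

open ConvexEmbedding

ConvexEmbedding-id : (C : Chain ℓ) → ConvexEmbedding (_<_ C) C
ConvexEmbedding-id C = record
  { embed = id ; order = mk⇔ id id ; convex = λ {_} {_} {z} _ _ → z , refl }

-- Convex extensions E are quantified over because the formula of a block is evaluated inside the
-- whole sum.
Defines : ∀ n {X : Set ℓ} → Rel X ℓ → Vector (Pred X ℓ) (paramCount n) → Rel X ℓ → Set (Level.suc ℓ)
Defines {ℓ} n {X} R P S =
  ∀ (E : Chain ℓ) (e : ConvexEmbedding R E) {k} (ix : Fin (paramCount n) → Fin k)
    (σ : Vector (Pred (Carrier E) ℓ) k) → (∀ t c → σ (ix t) (embed e c) ⇔ P t c) →
  ∀ a b → Sat E (φ n ix) (embed e a ∷ embed e b ∷ []) σ ⇔ S a b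

Defines-resp-⇔ : ∀ n {X : Set ℓ} {R S S′ : Rel X ℓ} {P} → (∀ {a b} → S a b ⇔ S′ a b) →
                 Defines n R P S → Defines n R P S′
Defines-resp-⇔ n S⇔S′ defines E e ix σ agree a b = S⇔S′ ⇔-∘ defines E e ix σ agree a b

Defines⇒Defined : ∀ n (C : Chain ℓ) {P S} → Defines n (_<_ C) P S →
            ∀ {a b} → Defined C (φ n id) P a b ⇔ S a b
Defines⇒Defined n C defines = defines C (ConvexEmbedding-id C) id _ (λ _ _ → mk⇔ id id) _ _

module _ {X Y : Set ℓ} {R : Rel X ℓ} {S : Rel Y ℓ} (iso : OrderIso X R Y S) where
  open OrderIso iso using (preserve; reflect; from-to; to-from) renaming (to to f; from to f⁻¹)

  OrderIso-⇔ : ∀ {a b} → R a b ⇔ S (f a) (f b)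
  OrderIso-⇔ = mk⇔ (preserve _ _) (reflect _ _)

  ConvexEmbedding-transport : ∀ {E : Chain ℓ} → ConvexEmbedding R E → ConvexEmbedding S E
  ConvexEmbedding-transport e = record
    { embed = embed e ∘ f⁻¹
    ; order = order e ⇔-∘ S⇔R
    ; convex = λ a<z z<b →
        Prod.map f (λ {c} → trans (cong (embed e) (from-to c))) (convex e a<z z<b)
    }
    where
    S⇔R : ∀ {p q} → S p q ⇔ R (f⁻¹ p) (f⁻¹ q)
    S⇔R {p} {q} =
      ⇔-sym (subst₂ (λ p′ q′ → R (f⁻¹ p) (f⁻¹ q) ⇔ S p′ q′) (to-from p) (to-from q) OrderIso-⇔)

  Defines-transport : ∀ n {Q S′} → Defines n S Q S′ → Defines n R (λ t → Q t ∘ f) (S′ on f)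
  Defines-transport n {Q} {S′} defines E e ix σ agree a b =
    subst₂ (λ a′ b′ → Sat E (φ n ix) (embed e a′ ∷ embed e b′ ∷ []) σ ⇔ S′ (f a) (f b))
           (from-to a) (from-to b)
           (defines E (ConvexEmbedding-transport e) ix σ agree′ (f a) (f b))
    where
    agree′ : ∀ t p → σ (ix t) (embed e (f⁻¹ p)) ⇔ Q t p
    agree′ t p = subst (λ p′ → σ (ix t) (embed e (f⁻¹ p)) ⇔ Q t p′) (to-from p) (agree t (f⁻¹ p))

Defines-oriented : ∀ b {X : Set ℓ} {R : Rel X ℓ} → Defines 1 R (λ _ _ → Lift ℓ (T b)) (orient b R)
Defines-oriented b {R = R} E e ix σ agree x y = begin
  Sat E (oriented (ix zero)) (embed e x ∷ embed e y ∷ []) σ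
    ∼⟨ Sat-oriented {E = E} {σ = σ} b (agree zero x) ⟩
  orient b (_<_ E) (embed e x) (embed e y)
    ∼⟨ ⇔-sym (orient-⇔ b (order e)) ⟩
  orient b R x y ∎
  where open EquationalReasoning

if-holds : ∀ {a b c} {B : Set a} {P : Set b} {Q : Set c} → B → ((¬ B × P) ⊎ (B × Q)) ⇔ Q
if-holds b =
  mk⇔ (λ { (inj₁ (¬b , _)) → contradiction b ¬b ; (inj₂ (_ , q)) → q }) (λ q → inj₂ (b , q))

if-fails : ∀ {a b c} {B : Set a} {P : Set b} {Q : Set c} → ¬ B → ((¬ B × P) ⊎ (B × Q)) ⇔ P
if-fails ¬b =
  mk⇔ (λ { (inj₁ (_ , p)) → p ; (inj₂ (b , _)) → contradiction b ¬b }) (λ p → inj₁ (¬b , p))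

-- Parameter 0 colours the blocks, parameter 1 fixes the orientation of the index order, and the
-- remaining ones are the parameters of the blocks.
lexParams : ∀ {n} {A : Set ℓ} {D : A → Set ℓ} → (A → Bool) → Bool →
            (∀ i → Vector (Pred (D i) ℓ) (paramCount (suc n))) →
            Vector (Pred (Σ A D) ℓ) (paramCount (suc (suc n)))
lexParams colour b P zero          (i , _) = Lift _ (T (colour i))
lexParams colour b P (suc zero)    _       = Lift _ (T b)
lexParams colour b P (suc (suc t)) (i , x) = P i t x

module _ {A : Set ℓ} {D : A → Set ℓ} {O : Rel A ℓ} (O-sto : IsStrictTotalOrder _≡_ O)
         {R : ∀ i → Rel (D i) ℓ} {E : Chain ℓ} (e : ConvexEmbedding (Lex O R) E) where

  private
    ι = embed e

    _≤ᴱ_ : Rel (Carrier E) (Level.suc ℓ)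
    u ≤ᴱ v = Lift (Level.suc ℓ) (_<_ E u v) ⊎ Lift (Level.suc ℓ) (u ≡ v)

    across : ∀ {i j x y} → O i j → ι (i , x) ≤ᴱ ι (j , y)
    across o = inj₁ (lift (to (order e) (inter o)))

  inBlock : ∀ {i x y z} → ι (i , x) ≤ᴱ z → z ≤ᴱ ι (i , y) → Σ[ w ∈ D i ] ι (i , w) ≡ z
  inBlock {x = x} (inj₂ (lift refl)) _ = x , refl
  inBlock {y = y} _ (inj₂ (lift refl)) = y , refl
  inBlock (inj₁ (lift x<z)) (inj₁ (lift z<y)) with convex e x<z z<y
  ... | (k , w) , refl with Lex-squeeze O-sto (from (order e) x<z) (from (order e) z<y)
  ...   | refl = w , refl

  blockEmbedding : ∀ i → ConvexEmbedding (R i) E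
  blockEmbedding i = record
    { embed = λ x → ι (i , x)
    ; order = order e ⇔-∘ ⇔-sym (Lex-within (IsStrictTotalOrder.irrefl O-sto refl))
    ; convex = λ x<z z<y → inBlock (inj₁ (lift x<z)) (inj₁ (lift z<y))
    }

  module _ {colour : A → Bool} {k} {σ : Vector (Pred (Carrier E) ℓ) k} {X : Fin k}
           (coloured : ∀ c → σ X (ι c) ⇔ Lift ℓ (T (colour (proj₁ c)))) where

    sameBlock-holds : ∀ {i x y} → Sat E (sameBlock X) (ι (i , x) ∷ ι (i , y) ∷ []) σ
    sameBlock-holds {i} {x} {y} (z , z-between , z-differs) =
      sameColour (inside z-between) z-differs
      where
      ρ = z ∷ ι (i , x) ∷ ι (i , y) ∷ []

      inside : Sat E (between (# 1) (# 0) (# 2)) ρ σ → Σ[ w ∈ D i ] ι (i , w) ≡ z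
      inside (inj₁ (x≤z , z≤y)) = inBlock x≤z z≤y
      inside (inj₂ (y≤z , z≤x)) = inBlock y≤z z≤x

      sameColour : Σ[ w ∈ D i ] ι (i , w) ≡ z → ¬ Sat E (differ (# 0) (# 1) X) ρ σ
      sameColour (w , refl) differs =
        to (exactlyOne⇔≢ (coloured (i , w)) (coloured (i , x))) differs refl

    sameBlock-fails : Separates O D colour → ∀ {i j x y} → i ≢ j →
                      ¬ Sat E (sameBlock X) (ι (i , x) ∷ ι (j , y) ∷ []) σ
    sameBlock-fails sep {i} {j} {x} {y} i≢j holds with sep x y i≢j
    ... | k , differs , inj₁ refl =
      holds (ι (k , y) , Sat-between-right {E = E} {σ = σ} (ι (i , x)) (ι (k , y)) ,
             from (exactlyOne⇔≢ (coloured (k , y)) (coloured (i , x))) differs)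
    ... | k , differs , inj₂ (w , i<k<j) =
      holds (ι (k , w) , embedBetween i<k<j ,
             from (exactlyOne⇔≢ (coloured (k , w)) (coloured (i , x))) differs)
      where
      embedBetween : Between O i k j →
                     Sat E (between (# 1) (# 0) (# 2)) (ι (k , w) ∷ ι (i , x) ∷ ι (j , y) ∷ []) σ
      embedBetween (inj₁ (i<k , k<j)) = inj₁ (across i<k , across k<j)
      embedBetween (inj₂ (j<k , k<i)) = inj₂ (across j<k , across k<i)

module _ {A : Set ℓ} {D : A → Set ℓ} {O : Rel A ℓ} (O-sto : IsStrictTotalOrder _≡_ O)
         {colour : A → Bool} (sep : Separates O D colour) (b : Bool) {n}
         {R S : ∀ i → Rel (D i) ℓ} {P : ∀ i → Vector (Pred (D i) ℓ) (paramCount (suc n))}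
         (defines : ∀ i → Defines (suc n) (R i) (P i) (S i)) where

  open IsStrictTotalOrder O-sto using (_≟_)

  Defines-Lex : Defines (suc (suc n)) (Lex O R) (lexParams colour b P) (Lex (orient b O) S)
  Defines-Lex E e ix σ agree (i , x) (j , y) = byBlocks (i ≟ j)
    where
    open EquationalReasoning
    ι = embed e
    ix′ = λ t → ix (suc (suc t))

    byBlocks : Dec (i ≡ j) → Sat E (φ (suc (suc n)) ix) (ι (i , x) ∷ ι (j , y) ∷ []) σ
                             ⇔ Lex (orient b O) S (i , x) (j , y)
    byBlocks (yes refl) = begin
      Sat E (φ (suc (suc n)) ix) (ι (i , x) ∷ ι (i , y) ∷ []) σ
        ∼⟨ if-holds (sameBlock-holds O-sto e {σ = σ} (agree zero)) ⟩
      Sat E (φ (suc n) ix′) (ι (i , x) ∷ ι (i , y) ∷ []) σ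
        ∼⟨ defines i E (blockEmbedding O-sto e i) ix′ σ (λ t w → agree (suc (suc t)) (i , w)) x y ⟩
      S i x y
        ∼⟨ ⇔-sym (Lex-within (IsStrictTotalOrder.irrefl (orient-isStrictTotalOrder b O-sto) refl)) ⟩
      Lex (orient b O) S (i , x) (i , y) ∎
    byBlocks (no i≢j) = begin
      Sat E (φ (suc (suc n)) ix) (ι (i , x) ∷ ι (j , y) ∷ []) σ
        ∼⟨ if-fails (sameBlock-fails O-sto e {σ = σ} (agree zero) sep i≢j) ⟩
      Sat E (oriented (ix (# 1))) (ι (i , x) ∷ ι (j , y) ∷ []) σ
        ∼⟨ Sat-oriented {E = E} {σ = σ} b (agree (# 1) (i , x)) ⟩
      orient b (_<_ E) (ι (i , x)) (ι (j , y))
        ∼⟨ ⇔-sym (orient-⇔ b (order e)) ⟩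
      orient b (Lex O R) (i , x) (j , y)
        ∼⟨ orient-Lex-across b i≢j ⟩
      orient b O i j
        ∼⟨ ⇔-sym (Lex-across i≢j) ⟩
      Lex (orient b O) S (i , x) (j , y) ∎

record InterdefinableWellOrder (n : ℕ) {X : Set ℓ} (_<_ : Rel X ℓ) : Set (Level.suc ℓ) where
  field
    _≺_            : Rel X ℓ
    isWellOrdering : IsWellOrdering _≺_
    params         : Vector (Pred X ℓ) (paramCount n)
    defines-≺      : Defines n _<_ params _≺_
    defines-<      : Defines n _≺_ params _<_

  isStrictTotalOrder : IsStrictTotalOrder _≡_ _≺_
  isStrictTotalOrder = proj₁ isWellOrdering

  wellFounded : WellFounded _≺_
  wellFounded = proj₂ isWellOrdering

open InterdefinableWellOrder

orientation : {A : Set ℓ} {O : Rel A ℓ} → WellFounded O ⊎ WellFounded (flip O) →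
              Σ[ b ∈ Bool ] WellFounded (orient b O)
orientation (inj₁ wf) = false , wf
orientation (inj₂ wf) = true , wf

interdefinable-oriented : ∀ b {X : Set ℓ} {R : Rel X ℓ} →
                          IsStrictTotalOrder _≡_ R → WellFounded (orient b R) →
                          InterdefinableWellOrder 1 R
interdefinable-oriented b {R = R} R-sto wf = record
  { _≺_ = orient b R
  ; isWellOrdering = orient-isStrictTotalOrder b R-sto , wf
  ; params = λ _ _ → Lift _ (T b)
  ; defines-≺ = Defines-oriented b
  ; defines-< = subst (Defines 1 (orient b R) _) (orient-involutive b) (Defines-oriented b)
  }

interdefinable-Lex : ExcludedMiddle ℓ →
  ∀ {n} {A : Set ℓ} {D : A → Set ℓ} {O : Rel A ℓ} {R : ∀ i → Rel (D i) ℓ} →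
  IsStrictTotalOrder _≡_ O → ∀ b → WellFounded (orient b O) →
  (∀ i → InterdefinableWellOrder (suc n) (R i)) → InterdefinableWellOrder (suc (suc n)) (Lex O R)
interdefinable-Lex em {n} {D = D} {O} {R} O-sto b wf W = record
  { _≺_ = Lex O′ ≺ᵢ
  ; isWellOrdering =
      Lex-isStrictTotalOrder O′-sto (isStrictTotalOrder ∘ W) , Lex-wellFounded wf (wellFounded ∘ W)
  ; params = P
  ; defines-≺ = Defines-Lex O-sto (Separates-unorient b separates) b (defines-≺ ∘ W)
  ; defines-< = subst (λ O″ → Defines (suc (suc n)) (Lex O′ ≺ᵢ) P (Lex O″ R)) (orient-involutive b)
                      (Defines-Lex O′-sto separates b (defines-< ∘ W))
  }
  where
  O′ = orient b O
  O′-sto = orient-isStrictTotalOrder b O-sto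
  ≺ᵢ = λ i → _≺_ (W i)
  open Colouring em O′-sto wf D using (colour; separates)
  P = lexParams colour b (params ∘ W)

module _ {X Y : Set ℓ} {R : Rel X ℓ} {S : Rel Y ℓ} (iso : OrderIso X R Y S) where
  open OrderIso iso using (preserve; reflect; from-to; to-from) renaming (to to f; from to f⁻¹)

  interdefinable-transport : ∀ {n} → InterdefinableWellOrder n S → InterdefinableWellOrder n R
  interdefinable-transport {n} W = record
    { _≺_ = _≺_ W on f
    ; isWellOrdering =
        isStrictTotalOrder-pullback f f-injective (mk⇔ id id) (isStrictTotalOrder W) ,
        On.wellFounded f (wellFounded W)
    ; params = λ t → params W t ∘ f
    ; defines-≺ = Defines-transport iso n (defines-≺ W)
    ; defines-< = Defines-resp-⇔ n (⇔-sym (OrderIso-⇔ iso)) (Defines-transport iso≺ n (defines-< W))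
    }
    where
    f-injective : ∀ {x y} → f x ≡ f y → x ≡ y
    f-injective {x} {y} fx≡fy = trans (sym (from-to x)) (trans (cong f⁻¹ fx≡fy) (from-to y))

    iso≺ : OrderIso X (_≺_ W on f) Y (_≺_ W)
    iso≺ = record { to = f ; from = f⁻¹ ; from-to = from-to ; to-from = to-from
                  ; preserve = λ _ _ → id ; reflect = λ _ _ → id }

interdefinable : ExcludedMiddle ℓ → ∀ n (C : Chain ℓ) → HdegLE n C →
                 InterdefinableWellOrder n (_<_ C)
interdefinable em zero C ()
interdefinable em (suc zero) C (lift wo) =
  let b , wf = orientation wo in interdefinable-oriented b (isSTO C) wf
interdefinable em (suc (suc n)) C (I , wo , D , hdeg , iso) =
  let b , wf = orientation wo in
  interdefinable-transport (OrderIso-Lex iso)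
    (interdefinable-Lex em (isSTO I) b wf (λ i → interdefinable em (suc n) (D i) (hdeg i)))

fact4p2 : (∀ {a} → ExcludedMiddle a) →
          ∀ {ℓ} (C : Chain ℓ) → Tame C → ReconstructibleWO C
fact4p2 em C (_ , n , hdeg) =
  paramCount n , φ n id , params W , α , wellFounded W ,
  isWellOrdering-resp-⇔ φ-defines-≺ (isWellOrdering W) , OrderIso-id φ-defines-≺ ,
  (paramCount n , φ n id , params W ,
   isStrictTotalOrder-pullback id id φ-defines-< (isSTO C) , OrderIso-id φ-defines-<)
  where
  W = interdefinable em n C hdeg
  α = record { Carrier = Carrier C ; _<_ = _≺_ W ; isSTO = isStrictTotalOrder W }
  φ-defines-≺ = Defines⇒Defined n C (defines-≺ W)
  φ-defines-< = Defines⇒Defined n α (defines-< W)
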